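{- For every real $\alpha>\frac{1}{2}$ there exist constants $\beta,\gamma>0$ and an integer $N_0$ such that the following holds for every $n\geq N_0$. Let $G$ be a simple edge-colored graph with $n$ vertices whose edge set is partitioned into $n$ color classes $\mathcal{F}=(F_1,\ldots,F_n)$, with $\mathcal{F}=\mathcal{F}_M\cup\mathcal{F}_T\cup\mathcal{F}_S$ where every $F_i\in\mathcal{F}_M$ is a matching of size $2$, every $F_i\in\mathcal{F}_T$ is a triangle, every $F_i\in\mathcal{F}_S$ is a single edge, and $|\mathcal{F}_M\cup\mathcal{F}_T|\geq\alpha n$. Then there exists a vertex subset $H\subseteq V(G)$ with $|H|\leq\beta n$ such that the induced subgraph $G[H]$ contains a rainbow edge set of size at least $(\beta+\gamma)n$.
   Context: An edge-colored graph is a graph $G$ with a map $c:E(G)\to\mathbb{N}$; the color classes are the sets of edges of a given color. A set of edges is rainbow if its distinct edges come from distinct color classes. A matching of size $2$ is a set of two vertex-disjoint edges; a triangle is the edge set of a $3$-cycle.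
   Formalization: The parameter α ranges over the rationals greater than 1/2 rather than the reals, and the constants β, γ are taken in ℚ. -}

module Defs where

open import Data.Nat using (ℕ)
open import Data.Fin using (Fin; _<_)
open import Data.Fin.Subset using (Subset; _∈_)
open import Data.Product using (_×_; _,_; ∃-syntax; proj₁)
open import Data.List using (List; []; _∷_; length; map; allFin)
open import Data.Nat.ListAction using (sum)
open import Data.List.Membership.Propositional renaming (_∈_ to _∈ₗ_)
open import Data.List.Relation.Unary.All using (All)
open import Data.List.Relation.Unary.Unique.Propositional using (Unique)

open import Data.Integer using (+_)
open import Data.Rational using (ℚ; _/_)
open import Relation.Binary.PropositionalEquality using (_≡_; _≢_)
open import Relation.Nullary using (Dec; yes; no)

-- An edge of a simple graph on vertex set Fin n: an unordered pair {u,v},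
-- u ≠ v, stored canonically as (u , v) with u < v.
Edge : ℕ → Set
Edge n = Fin n × Fin n

IsEdge : ∀ {n} → Edge n → Set
IsEdge (u , v) = u < v

data Shape : Set where
  matching2 triangle single : Shape

IsMatching2 : ∀ {n} → List (Edge n) → Set
IsMatching2 {n} F = ∃[ a ] ∃[ b ] ∃[ c ] ∃[ d ]
  (a < b × c < d × a ≢ c × a ≢ d × b ≢ c × b ≢ d ×
   F ≡ (a , b) ∷ (c , d) ∷ [])

IsTriangle : ∀ {n} → List (Edge n) → Set
IsTriangle {n} F = ∃[ a ] ∃[ b ] ∃[ c ]
  (a < b × b < c × F ≡ (a , b) ∷ (b , c) ∷ (a , c) ∷ [])

IsSingle : ∀ {n} → List (Edge n) → Set
IsSingle {n} F = ∃[ a ] ∃[ b ] (a < b × F ≡ (a , b) ∷ [])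

HasShape : ∀ {n} → Shape → List (Edge n) → Set
HasShape matching2 F = IsMatching2 F
HasShape triangle  F = IsTriangle F
HasShape single    F = IsSingle F

-- Colour classes F i (i : Fin n) are pairwise disjoint, so their union is a
-- simple graph whose edge set is partitioned into the classes.
PairwiseDisjoint : ∀ {n} → (Fin n → List (Edge n)) → Set
PairwiseDisjoint {n} F = ∀ (i j : Fin n) (e : Edge n) → e ∈ₗ F i → e ∈ₗ F j → i ≡ j

inMT : Shape → ℕ
inMT matching2 = 1
inMT triangle  = 1
inMT single    = 0

countMT : ∀ {n} → (Fin n → Shape) → ℕ
countMT {n} shape = sum (map (λ i → inMT (shape i)) (allFin n))

-- R is a rainbow edge set of the induced subgraph G[H]: a list of
-- (colour, edge) pairs, each edge lying in its colour class with both
-- endpoints in H, and the colours pairwise distinct.  (Distinct colours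
-- force distinct edges since the classes are disjoint.)
RainbowIn : ∀ {n} → (Fin n → List (Edge n)) → Subset n → List (Fin n × Edge n) → Set
RainbowIn F H R =
  All (λ { (c , (u , v)) → ((u , v) ∈ₗ F c) × (u ∈ H) × (v ∈ H) }) R
  × Unique (map proj₁ R)

ℕ→ℚ : ℕ → ℚ
ℕ→ℚ m = (+ m) / 1

-- Write α = p/Q and call a vertex good if no single-edge class touches it and it lies on fewer
-- than T = 12Q of the 2-matching/triangle classes.  Single edges touch at most 2(1 − α)n vertices,
-- and as the 2-matchings and triangles have at most 6n endpoints, at most n/(2Q) vertices lie on
-- T of them; since α > 1/2, at least n/(2Q) vertices are good.  Greedily pick a maximal set D of
-- good vertices no two of which share a 2-matching or triangle.  Each good vertex is in D or
-- shares such a class with a member of D, and a good vertex shares one with fewer than 6T others,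
-- so |D| ≥ n/(144Q²).  Deleting D keeps an edge of every colour, because a single edge misses D
-- and a 2-matching or triangle meets D at most once; so H = V ∖ D carries a rainbow set with all
-- n colours while |H| ≤ βn for some β < 1.

module Submission where

open import Defs
open import Data.Fin using (Fin)
open import Data.List using (List)
open import Relation.Binary using (Rel; Symmetric)
open import Relation.Nullary using (Dec)
open import Relation.Unary using (Pred; Decidable)

module Counting where

  open import Data.Bool using (if_then_else_)
  open import Data.Empty using (⊥-elim)
  open import Data.Fin using (Fin; zero; suc; _≟_)
  open import Data.Fin.Subset using (Subset; ∣_∣; inside; outside)
  open import Data.Fin.Subset.Properties using (_∈?_)
  open import Data.List using (List; []; _∷_; length; tabulate)
  open import Data.List.Membership.Propositional using () renaming (_∈_ to _∈ₗ_)
  open import Data.List.Relation.Unary.Any using (here; there) renaming (any? to anyₗ?)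
  open import Data.Nat using (ℕ; zero; suc; _+_; _*_; _≤_; _≤?_; z≤n; s≤s)
  open import Data.Nat.ListAction using () renaming (sum to sumₗ)
  open import Data.Nat.Properties hiding (_≟_)
  open import Data.Product using (_×_; _,_; ∃-syntax)
  open import Data.Sum using (_⊎_; inj₁; inj₂)
  open import Data.Vec using (_∷_; [])
  open import Function using (_∘_)
  open import Relation.Binary.PropositionalEquality using (_≡_; refl; sym; trans; cong)
  open import Relation.Nullary using (Dec; yes; no; does)
  open import Relation.Nullary.Decidable using (_⊎-dec_; ¬?)
  open import Relation.Unary using (Pred; Decidable)

  open import Algebra.Properties.Semiring.Sum +-*-semiring public
    using (sum; sum-cong-≗; ∑-comm; ∑-distrib-+; *-distribˡ-sum)

  ∑-mono-≤ : ∀ {n} {f g : Fin n → ℕ} → (∀ i → f i ≤ g i) → sum f ≤ sum g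
  ∑-mono-≤ {zero}  f≤g = z≤n
  ∑-mono-≤ {suc n} f≤g = +-mono-≤ (f≤g zero) (∑-mono-≤ (f≤g ∘ suc))

  ∑-const : ∀ n k → sum {n} (λ _ → k) ≡ n * k
  ∑-const zero    k = refl
  ∑-const (suc n) k = cong (k +_) (∑-const n k)

  ∑-ones : ∀ {n} {f : Fin n → ℕ} → (∀ i → f i ≡ 1) → sum f ≡ n
  ∑-ones {n} f≡1 = trans (sum-cong-≗ f≡1) (trans (∑-const n 1) (*-identityʳ n))

  term≤∑ : ∀ {n} (f : Fin n → ℕ) i → f i ≤ sum f
  term≤∑ f zero    = m≤m+n _ _
  term≤∑ f (suc i) = ≤-trans (term≤∑ (f ∘ suc) i) (m≤n+m _ _)

  𝟙 : ∀ {p} {P : Set p} → Dec P → ℕ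
  𝟙 P? = if does P? then 1 else 0

  𝟙-mono : ∀ {p q} {P : Set p} {Q : Set q} (P? : Dec P) (Q? : Dec Q) → (P → Q) → 𝟙 P? ≤ 𝟙 Q?
  𝟙-mono (yes p) (yes _) P⇒Q = ≤-refl
  𝟙-mono (yes p) (no ¬q) P⇒Q = ⊥-elim (¬q (P⇒Q p))
  𝟙-mono (no _)  Q?      P⇒Q = z≤n

  count : ∀ {n p} {P : Pred (Fin n) p} → Decidable P → ℕ
  count P? = sum (λ x → 𝟙 (P? x))

  count-mono : ∀ {n p q} {P : Pred (Fin n) p} {Q : Pred (Fin n) q} (P? : Decidable P) (Q? : Decidable Q) →
    (∀ x → P x → Q x) → count P? ≤ count Q?
  count-mono P? Q? P⇒Q = ∑-mono-≤ (λ x → 𝟙-mono (P? x) (Q? x) (P⇒Q x))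

  count-⊎ : ∀ {n p q} {P : Pred (Fin n) p} {Q : Pred (Fin n) q} (P? : Decidable P) (Q? : Decidable Q) →
    count (λ x → P? x ⊎-dec Q? x) ≤ count P? + count Q?
  count-⊎ P? Q? = ≤-trans (∑-mono-≤ (λ x → 𝟙-⊎ (P? x) (Q? x)))
    (≤-reflexive (∑-distrib-+ (λ x → 𝟙 (P? x)) (λ x → 𝟙 (Q? x))))
    where
    𝟙-⊎ : ∀ {p q} {P : Set p} {Q : Set q} (P? : Dec P) (Q? : Dec Q) → 𝟙 (P? ⊎-dec Q?) ≤ 𝟙 P? + 𝟙 Q?
    𝟙-⊎ (yes _) Q? = s≤s z≤n
    𝟙-⊎ (no _)  Q? = ≤-refl

  count-total : ∀ {n p} {P : Pred (Fin n) p} (P? : Decidable P) → (∀ x → P x) → count P? ≡ n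
  count-total P? all = ∑-ones 𝟙≡1
    where
    𝟙≡1 : ∀ x → 𝟙 (P? x) ≡ 1
    𝟙≡1 x with P? x
    ... | yes _  = refl
    ... | no ¬px = ⊥-elim (¬px (all x))

  count-≡ : ∀ {n} (y : Fin n) → count (_≟ y) ≡ 1
  count-≡ {suc n} zero    = cong suc (trans (∑-const n 0) (*-zeroʳ n))
  count-≡ {suc n} (suc y) = count-≡ y

  count-¬ : ∀ {n p} {P : Pred (Fin n) p} (P? : Decidable P) → count (¬? ∘ P?) + count P? ≡ n
  count-¬ P? = trans (sym (∑-distrib-+ (λ x → 𝟙 (¬? (P? x))) (λ x → 𝟙 (P? x)))) (∑-ones (λ x → 𝟙-¬ (P? x)))
    where
    𝟙-¬ : ∀ {p} {P : Set p} (P? : Dec P) → 𝟙 (¬? P?) + 𝟙 P? ≡ 1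
    𝟙-¬ (yes _) = refl
    𝟙-¬ (no _)  = refl

  markov : ∀ {n} k (f : Fin n → ℕ) → k * count (λ x → k ≤? f x) ≤ sum f
  markov k f = ≤-trans (≤-reflexive (*-distribˡ-sum k (λ x → 𝟙 (k ≤? f x)))) (∑-mono-≤ (λ x → weighted (k ≤? f x)))
    where
    weighted : ∀ {m} (k≤?m : Dec (k ≤ m)) → k * 𝟙 k≤?m ≤ m
    weighted (yes k≤m) = ≤-trans (≤-reflexive (*-identityʳ k)) k≤m
    weighted (no _)    = ≤-trans (≤-reflexive (*-zeroʳ k)) z≤n

  count-cover : ∀ {m k p q r} {P : Pred (Fin m) p} {Q : Pred (Fin k) q} {R : Fin m → Fin k → Set r}
    (P? : Decidable P) (Q? : Decidable Q) (R? : ∀ x j → Dec (R x j)) (K : ℕ) →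
    (∀ x → P x → ∃[ j ] (Q j × R x j)) → (∀ j → Q j → count (λ x → R? x j) ≤ K) →
    count P? ≤ K * count Q?
  count-cover P? Q? R? K cover bound = begin
    sum (λ x → 𝟙 (P? x))                              ≤⟨ ∑-mono-≤ charge ⟩
    sum (λ x → sum (λ j → 𝟙 (Q? j) * 𝟙 (R? x j)))      ≡⟨ ∑-comm (λ x j → 𝟙 (Q? j) * 𝟙 (R? x j)) ⟩
    sum (λ j → sum (λ x → 𝟙 (Q? j) * 𝟙 (R? x j)))      ≡⟨ sum-cong-≗ (λ j → *-distribˡ-sum (𝟙 (Q? j)) (λ x → 𝟙 (R? x j))) ⟨
    sum (λ j → 𝟙 (Q? j) * count (λ x → R? x j))        ≤⟨ ∑-mono-≤ weigh ⟩
    sum (λ j → K * 𝟙 (Q? j))                           ≡⟨ sym (*-distribˡ-sum K (λ j → 𝟙 (Q? j))) ⟩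
    K * count Q?                                       ∎
    where
    open ≤-Reasoning
    charge : ∀ x → 𝟙 (P? x) ≤ sum (λ j → 𝟙 (Q? j) * 𝟙 (R? x j))
    charge x with P? x
    ... | no _ = z≤n
    ... | yes px with cover x px
    ...   | j , qj , rxj with Q? j | R? x j | term≤∑ (λ j → 𝟙 (Q? j) * 𝟙 (R? x j)) j
    ...     | yes _ | yes _ | le = le
    ...     | no ¬qj | _ | _ = ⊥-elim (¬qj qj)
    ...     | yes _ | no ¬rxj | _ = ⊥-elim (¬rxj rxj)
    weigh : ∀ j → 𝟙 (Q? j) * count (λ x → R? x j) ≤ K * 𝟙 (Q? j)
    weigh j with Q? j
    ... | yes qj = ≤-trans (≤-reflexive (+-identityʳ _)) (≤-trans (bound j qj) (≤-reflexive (sym (*-identityʳ K))))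
    ... | no _   = z≤n

  infix 4 _∈ₗ?_
  _∈ₗ?_ : ∀ {n} (v : Fin n) (xs : List (Fin n)) → Dec (v ∈ₗ xs)
  v ∈ₗ? xs = anyₗ? (v ≟_) xs

  sumₗ-tabulate : ∀ {n} (f : Fin n → ℕ) → sumₗ (tabulate f) ≡ sum f
  sumₗ-tabulate {zero}  f = refl
  sumₗ-tabulate {suc n} f = cong (f zero +_) (sumₗ-tabulate (f ∘ suc))

  ∣p∣≡count : ∀ {n} (p : Subset n) → ∣ p ∣ ≡ count (_∈? p)
  ∣p∣≡count []            = refl
  ∣p∣≡count (inside ∷ p)  = cong suc (∣p∣≡count p)
  ∣p∣≡count (outside ∷ p) = ∣p∣≡count p

  count-∈ₗ : ∀ {n} (xs : List (Fin n)) → count (_∈ₗ? xs) ≤ length xs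
  count-∈ₗ {n} [] = ≤-reflexive (trans (∑-const n 0) (*-zeroʳ n))
  count-∈ₗ (y ∷ ys) = begin
    count (_∈ₗ? y ∷ ys)                        ≤⟨ count-mono (_∈ₗ? y ∷ ys) (λ v → v ≟ y ⊎-dec v ∈ₗ? ys) split ⟩
    count (λ v → v ≟ y ⊎-dec v ∈ₗ? ys)          ≤⟨ count-⊎ (_≟ y) (_∈ₗ? ys) ⟩
    count (_≟ y) + count (_∈ₗ? ys)              ≤⟨ +-mono-≤ (≤-reflexive (count-≡ y)) (count-∈ₗ ys) ⟩
    suc (length ys)                             ∎
    where
    open ≤-Reasoning
    split : ∀ v → v ∈ₗ y ∷ ys → v ≡ y ⊎ v ∈ₗ ys
    split v (here v≡y) = inj₁ v≡y
    split v (there v∈ys) = inj₂ v∈ys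

module MaximalIndependentSet {n p r} {P : Pred (Fin n) p} (P? : Decidable P)
  {_~_ : Rel (Fin n) r} (_~?_ : ∀ x y → Dec (x ~ y)) (~-sym : Symmetric _~_) where

  open import Data.Empty using (⊥-elim)
  open import Data.Fin using (Fin; _≟_)
  open import Data.Fin.Properties using (any?)
  open import Data.Fin.Subset using (Subset; _∈_; _⊆_; _∪_; ⁅_⁆; ⊥)
  open import Data.Fin.Subset.Properties using (_∈?_; ∉⊥; x∈p∪q⁺; x∈p∪q⁻; x∈⁅x⁆; x∈⁅y⁆⇒x≡y; p⊆p∪q)
  open import Data.List using (List; []; _∷_; allFin)
  open import Data.List.Membership.Propositional using () renaming (_∈_ to _∈ₗ_)
  open import Data.List.Membership.Propositional.Properties using (∈-allFin)
  open import Data.List.Relation.Unary.Any using (here; there)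
  open import Data.Product using (_×_; _,_; ∃-syntax)
  open import Data.Sum using (_⊎_; inj₁; inj₂)
  open import Function using (_∘_; id)
  open import Level using (_⊔_)
  open import Relation.Binary.PropositionalEquality using (_≡_; _≢_; refl; sym; trans)
  open import Relation.Nullary using (Dec; yes; no; ¬_)
  open import Relation.Nullary.Decidable using (_×-dec_; _⊎-dec_)

  Dominates : Subset n → Fin n → Set r
  Dominates D x = ∃[ d ] (d ∈ D × (x ≡ d ⊎ x ~ d))

  record Independent (D : Subset n) : Set (p ⊔ r) where
    field
      ⊆P   : ∀ {x} → x ∈ D → P x
      free : ∀ {x y} → x ∈ D → y ∈ D → x ≢ y → ¬ x ~ y

  dominates? : ∀ D x → Dec (Dominates D x)
  dominates? D x = any? (λ d → d ∈? D ×-dec (x ≟ d ⊎-dec x ~? d))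

  dominates-mono : ∀ {D D′ x} → D ⊆ D′ → Dominates D x → Dominates D′ x
  dominates-mono D⊆D′ (d , d∈D , x≈d) = d , D⊆D′ d∈D , x≈d

  ⊥-independent : Independent ⊥
  ⊥-independent = record { ⊆P = ⊥-elim ∘ ∉⊥ ; free = λ x∈⊥ _ _ → ⊥-elim (∉⊥ x∈⊥) }

  insert-independent : ∀ {D x} → Independent D → P x → ¬ Dominates D x → Independent (D ∪ ⁅ x ⁆)
  insert-independent {D} {x} ind px undominated = record { ⊆P = ⊆P′ ; free = free′ }
    where
    open Independent ind
    ⊆P′ : ∀ {y} → y ∈ D ∪ ⁅ x ⁆ → P y
    ⊆P′ y∈ with x∈p∪q⁻ D ⁅ x ⁆ y∈
    ... | inj₁ y∈D  = ⊆P y∈D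
    ... | inj₂ y∈⁅x⁆ rewrite x∈⁅y⁆⇒x≡y x y∈⁅x⁆ = px
    free′ : ∀ {y z} → y ∈ D ∪ ⁅ x ⁆ → z ∈ D ∪ ⁅ x ⁆ → y ≢ z → ¬ y ~ z
    free′ y∈ z∈ y≢z with x∈p∪q⁻ D ⁅ x ⁆ y∈ | x∈p∪q⁻ D ⁅ x ⁆ z∈
    ... | inj₁ y∈D | inj₁ z∈D = free y∈D z∈D y≢z
    ... | inj₂ y∈⁅x⁆ | inj₁ z∈D rewrite x∈⁅y⁆⇒x≡y x y∈⁅x⁆ = λ x~z → undominated (_ , z∈D , inj₂ x~z)
    ... | inj₁ y∈D | inj₂ z∈⁅x⁆ rewrite x∈⁅y⁆⇒x≡y x z∈⁅x⁆ = λ y~x → undominated (_ , y∈D , inj₂ (~-sym y~x))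
    ... | inj₂ y∈⁅x⁆ | inj₂ z∈⁅x⁆ = ⊥-elim (y≢z (trans (x∈⁅y⁆⇒x≡y x y∈⁅x⁆) (sym (x∈⁅y⁆⇒x≡y x z∈⁅x⁆))))

  greedy : ∀ (xs : List (Fin n)) D → Independent D →
           ∃[ D′ ] (Independent D′ × D ⊆ D′ × (∀ {x} → x ∈ₗ xs → P x → Dominates D′ x))
  greedy [] D ind = D , ind , id , λ ()
  greedy (x ∷ xs) D ind with dominates? D x | P? x
  ... | yes dom | _ with greedy xs D ind
  ...   | D′ , ind′ , D⊆D′ , cover = D′ , ind′ , D⊆D′ , λ
          { (here refl) _ → dominates-mono D⊆D′ dom
          ; (there x∈xs) → cover x∈xs }
  greedy (x ∷ xs) D ind | no _ | no ¬px with greedy xs D ind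
  ...   | D′ , ind′ , D⊆D′ , cover = D′ , ind′ , D⊆D′ , λ
          { (here refl) px → ⊥-elim (¬px px)
          ; (there x∈xs) → cover x∈xs }
  greedy (x ∷ xs) D ind | no undom | yes px with greedy xs (D ∪ ⁅ x ⁆) (insert-independent ind px undom)
  ...   | D′ , ind′ , D∪x⊆D′ , cover = D′ , ind′ , D∪x⊆D′ ∘ p⊆p∪q ⁅ x ⁆ , λ
          { (here refl) _ → x , D∪x⊆D′ (x∈p∪q⁺ (inj₂ (x∈⁅x⁆ x))) , inj₁ refl
          ; (there x∈xs) → cover x∈xs }

  maximal-independent : ∃[ D ] (Independent D × (∀ {x} → P x → Dominates D x))
  maximal-independent with greedy (allFin n) ⊥ ⊥-independent
  ... | D , ind , _ , cover = D , ind , cover (∈-allFin _)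

module Arithmetic where

  open import Data.Fin.Subset using (Subset; ∁; ∣_∣)
  open import Data.Fin.Subset.Properties using (∣∁p∣≡n∸∣p∣)
  open import Data.List using (_∷_; [])
  open import Data.Nat
  open import Data.Nat.Properties
  open import Data.Nat.Tactic.RingSolver using (solve)
  open import Relation.Binary.PropositionalEquality using (_≡_; cong)

  -- α = p/Q; m classes are 2-matchings or triangles and s are single edges; G vertices are good
  -- and B lie on at least 12Q of the m classes.
  good-fraction : ∀ {p Q n m s G B} → suc Q ≤ 2 * p → p * n ≤ Q * m → s + m ≡ n →
    n ≤ G + (2 * s + B) → 12 * Q * B ≤ 6 * n → n ≤ 2 * Q * G
  good-fraction {p} {Q} {n} {m} {s} {G} {B} Q<2p pn≤Qm s+m≡n partition heavy =
    +-cancelˡ-≤ (2 * Q * n + n) n (2 * Q * G) (begin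
      2 * Q * n + n + n                  ≡⟨ solve (Q ∷ n ∷ []) ⟩
      2 * Q * n + 2 * n                  ≤⟨ +-monoˡ-≤ (2 * n) (*-monoʳ-≤ (2 * Q) partition) ⟩
      2 * Q * (G + (2 * s + B)) + 2 * n  ≡⟨ solve (Q ∷ n ∷ G ∷ s ∷ B ∷ []) ⟩
      2 * Q * G + (4 * Q * s + 2 * n) + 2 * Q * B
                                         ≤⟨ +-mono-≤ (+-monoʳ-≤ (2 * Q * G) few-singles) few-heavy ⟩
      2 * Q * G + 2 * Q * n + n          ≡⟨ solve (Q ∷ n ∷ G ∷ []) ⟩
      2 * Q * n + n + 2 * Q * G          ∎)
    where
    open ≤-Reasoning
    few-heavy : 2 * Q * B ≤ n
    few-heavy = *-cancelˡ-≤ 6 (begin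
      6 * (2 * Q * B) ≡⟨ solve (Q ∷ B ∷ []) ⟩
      12 * Q * B      ≤⟨ heavy ⟩
      6 * n           ∎)
    few-singles : 4 * Q * s + 2 * n ≤ 2 * Q * n
    few-singles = +-cancelˡ-≤ (2 * Q * n) _ _ (begin
      2 * Q * n + (4 * Q * s + 2 * n) ≡⟨ solve (Q ∷ n ∷ s ∷ []) ⟩
      4 * Q * s + 2 * (suc Q * n)     ≤⟨ +-monoʳ-≤ (4 * Q * s) (*-monoʳ-≤ 2 (*-monoˡ-≤ n Q<2p)) ⟩
      4 * Q * s + 2 * (2 * p * n)     ≡⟨ solve (p ∷ Q ∷ n ∷ s ∷ []) ⟩
      4 * Q * s + 4 * (p * n)         ≤⟨ +-monoʳ-≤ (4 * Q * s) (*-monoʳ-≤ 4 pn≤Qm) ⟩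
      4 * Q * s + 4 * (Q * m)         ≡⟨ solve (Q ∷ s ∷ m ∷ []) ⟩
      4 * Q * (s + m)                 ≡⟨ cong (4 * Q *_) s+m≡n ⟩
      4 * Q * n                       ≡⟨ solve (Q ∷ n ∷ []) ⟩
      2 * Q * n + 2 * Q * n           ∎)

  complement-bound : ∀ {n} k (p : Subset n) → n ≤ suc k * ∣ p ∣ → ∣ ∁ p ∣ * suc k ≤ k * n
  complement-bound {n} k p n≤ = begin
    ∣ ∁ p ∣ * suc k            ≡⟨ cong (_* suc k) (∣∁p∣≡n∸∣p∣ p) ⟩
    (n ∸ ∣ p ∣) * suc k        ≡⟨ *-distribʳ-∸ (suc k) n ∣ p ∣ ⟩
    n * suc k ∸ ∣ p ∣ * suc k  ≤⟨ ∸-monoʳ-≤ (n * suc k) (≤-trans n≤ (≤-reflexive (*-comm (suc k) ∣ p ∣))) ⟩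
    n * suc k ∸ n              ≡⟨ cong (_∸ n) (*-suc n k) ⟩
    n + n * k ∸ n              ≡⟨ m+n∸m≡n n (n * k) ⟩
    n * k                      ≡⟨ *-comm n k ⟩
    k * n                      ∎
    where open ≤-Reasoning

module RationalBounds where

  open import Data.Nat as ℕ using (ℕ; suc; z≤n; s≤s)
  import Data.Nat.Properties as ℕ
  open import Data.Nat.Coprimality using (Coprime)
  open import Data.Integer as ℤ using (ℤ; +_; +≤+; +<+)
  import Data.Integer.Properties as ℤ
  open import Data.Integer.Tactic.RingSolver using (solve-∀)
  open import Data.Rational using (ℚ; ½; 0ℚ; 1ℚ; mkℚ; toℚᵘ; _/_; _<_; _≤_; _*_; _+_; *<*)
  open import Data.Rational.Properties
    using (toℚᵘ-fromℚᵘ; toℚᵘ-mono-≤; toℚᵘ-cancel-≤; toℚᵘ-cancel-<; toℚᵘ-homo-*; toℚᵘ-homo-+; toℚᵘ-injective)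
  open import Data.Rational.Unnormalised as ℚᵘ using (ℚᵘ; mkℚᵘ; _≃_; *≤*; *<*; *≡*)
  import Data.Rational.Unnormalised.Properties as ℚᵘ
  open import Relation.Binary.PropositionalEquality using (_≡_; refl; sym; trans; cong; subst; subst₂)

  toℚᵘ-/ : ∀ i d → toℚᵘ (i / suc d) ≃ mkℚᵘ i d
  toℚᵘ-/ i d = toℚᵘ-fromℚᵘ (mkℚᵘ i d)

  toℚᵘ-*ℕ→ℚ : ∀ r n → toℚᵘ (r * ℕ→ℚ n) ≃ toℚᵘ r ℚᵘ.* mkℚᵘ (+ n) 0
  toℚᵘ-*ℕ→ℚ r n = ℚᵘ.≃-trans (toℚᵘ-homo-* r (ℕ→ℚ n)) (ℚᵘ.*-cong (ℚᵘ.≃-refl {toℚᵘ r}) (toℚᵘ-/ (+ n) 0))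

  ½<⇒ : ∀ {p q} .{c : Coprime p (suc q)} → ½ < mkℚ (+ p) q c → suc (suc q) ℕ.≤ 2 ℕ.* p
  ½<⇒ {p} {q} (*<* lt) with subst₂ ℤ._<_ (sym (ℤ.pos-* 1 (suc q))) (sym (ℤ.pos-* p 2)) lt
  ... | +<+ 1+q<2p = subst₂ ℕ._≤_ (cong suc (ℕ.+-identityʳ (suc q))) (ℕ.*-comm p 2) 1+q<2p

  frac*ℕ→ℚ≤ℕ→ℚ : ∀ {p q} .{c : Coprime p (suc q)} n m →
    mkℚ (+ p) q c * ℕ→ℚ n ≤ ℕ→ℚ m → p ℕ.* n ℕ.≤ suc q ℕ.* m
  frac*ℕ→ℚ≤ℕ→ℚ {p} {q} {c} n m le
    with ℚᵘ.≤-respʳ-≃ (toℚᵘ-/ (+ m) 0) (ℚᵘ.≤-respˡ-≃ (toℚᵘ-*ℕ→ℚ (mkℚ (+ p) q c) n) (toℚᵘ-mono-≤ le))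
  ... | *≤* x with subst₂ ℤ._≤_ (trans (ℤ.*-identityʳ _) (ℤ.+◃n≡+n (p ℕ.* n))) (sym (ℤ.pos-* m (suc (q ℕ.* 1)))) x
  ... | +≤+ y = subst (p ℕ.* n ℕ.≤_) (trans (ℕ.*-comm m _) (cong (λ k → suc k ℕ.* m) (ℕ.*-identityʳ q))) y

  ℕ→ℚ≤frac*ℕ→ℚ : ∀ h a d n → h ℕ.* suc d ℕ.≤ a ℕ.* n → ℕ→ℚ h ≤ (+ a / suc d) * ℕ→ℚ n
  ℕ→ℚ≤frac*ℕ→ℚ h a d n le = toℚᵘ-cancel-≤ (ℚᵘ.≤-respˡ-≃ (ℚᵘ.≃-sym (toℚᵘ-/ (+ h) 0))
    (ℚᵘ.≤-respʳ-≃ (ℚᵘ.≃-sym (ℚᵘ.≃-trans (toℚᵘ-*ℕ→ℚ (+ a / suc d) n) (ℚᵘ.*-cong (toℚᵘ-/ (+ a) d) ℚᵘ.≃-refl)))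
      (*≤* (subst₂ ℤ._≤_ (ℤ.pos-* h (suc (d ℕ.* 1))) (sym (trans (ℤ.*-identityʳ _) (ℤ.+◃n≡+n (a ℕ.* n))))
        (+≤+ (subst (λ k → h ℕ.* suc k ℕ.≤ a ℕ.* n) (sym (ℕ.*-identityʳ d)) le))))))

  0<frac : ∀ a d → 0ℚ < + suc a / suc d
  0<frac a d = toℚᵘ-cancel-< (ℚᵘ.<-respʳ-≃ (ℚᵘ.≃-sym (toℚᵘ-/ (+ suc a) d)) (*<* (+<+ (s≤s z≤n))))

  frac+frac≡1 : ∀ k → + k / suc k + + 1 / suc k ≡ 1ℚ
  frac+frac≡1 k = toℚᵘ-injective (ℚᵘ.≃-trans (toℚᵘ-homo-+ (+ k / suc k) (+ 1 / suc k))
    (ℚᵘ.≃-trans (ℚᵘ.+-cong (toℚᵘ-/ (+ k) k) (toℚᵘ-/ (+ 1) k)) (*≡* (cross-multiplied (+ k)))))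
    where
    cross-multiplied : ∀ x → (x ℤ.* (+ 1 ℤ.+ x) ℤ.+ + 1 ℤ.* (+ 1 ℤ.+ x)) ℤ.* + 1 ≡ + 1 ℤ.* ((+ 1 ℤ.+ x) ℤ.* (+ 1 ℤ.+ x))
    cross-multiplied = solve-∀

module ColourClasses {n} (F : Fin n → List (Edge n)) (shape : Fin n → Shape)
                     (hs : ∀ i → HasShape (shape i) (F i)) where

  open import Data.Empty using (⊥-elim)
  open import Data.Fin using (Fin; _≟_)
  open import Data.Fin.Properties using (any?; <⇒≢; <-trans)
  open import Data.Fin.Subset using (Subset; _∈_; _∉_; ∁; ∣_∣)
  open import Data.Fin.Subset.Properties using (_∈?_; x∉p⇒x∈∁p)
  open import Data.List using (List; []; _∷_; length; tabulate; map)
  open import Data.List.Membership.Propositional using () renaming (_∈_ to _∈ₗ_)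
  open import Data.List.Properties using (length-tabulate; map-tabulate)
  open import Data.List.Relation.Unary.All.Properties using (tabulate⁺)
  open import Data.List.Relation.Unary.Any using (here; there)
  open import Data.List.Relation.Unary.Unique.Propositional using (Unique)
  open import Data.List.Relation.Unary.Unique.Propositional.Properties using (allFin⁺)
  open import Data.Nat using (ℕ; suc; _+_; _*_; _≤_; _≤?_; z≤n; s≤s) renaming (_≟_ to _≟ℕ_)
  open import Data.Nat.Properties hiding (_≟_; <⇒≢; <-trans)
  open import Data.Nat.ListAction using () renaming (sum to sumₗ)
  open import Data.Nat.Tactic.RingSolver using (solve-∀)
  open import Data.Product as Product using (_×_; _,_; ∃-syntax; proj₁; proj₂)
  open import Data.Sum using (_⊎_; inj₁; inj₂)
  open import Function using (_∘_)
  open import Relation.Binary.PropositionalEquality using (_≡_; _≢_; refl; sym; trans; cong; subst; module ≡-Reasoning)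
  open import Relation.Nullary using (Dec; yes; no; ¬_)
  open import Relation.Nullary.Decidable using (_×-dec_; _⊎-dec_; ¬?)

  open Counting
  open Arithmetic using (good-fraction)

  endpoints : List (Edge n) → List (Fin n)
  endpoints []             = []
  endpoints ((u , v) ∷ es) = u ∷ v ∷ endpoints es

  IsMT : Fin n → Set
  IsMT i = inMT (shape i) ≡ 1

  isMT? : ∀ i → Dec (IsMT i)
  isMT? i = inMT (shape i) ≟ℕ 1

  Touches : Fin n → Fin n → Set
  Touches i v = v ∈ₗ endpoints (F i)

  touches? : ∀ i v → Dec (Touches i v)
  touches? i v = v ∈ₗ? endpoints (F i)

  count-isMT : count isMT? ≡ countMT shape
  count-isMT = begin
    count isMT?                                     ≡⟨ sum-cong-≗ (λ i → 𝟙-isMT (shape i)) ⟩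
    sum (λ i → inMT (shape i))                      ≡⟨ sumₗ-tabulate (λ i → inMT (shape i)) ⟨
    sumₗ (tabulate (λ i → inMT (shape i)))          ≡⟨ cong sumₗ (map-tabulate (λ i → i) (λ i → inMT (shape i))) ⟨
    countMT shape                                   ∎
    where
    open ≡-Reasoning
    𝟙-isMT : ∀ s → 𝟙 (inMT s ≟ℕ 1) ≡ inMT s
    𝟙-isMT matching2 = refl
    𝟙-isMT triangle  = refl
    𝟙-isMT single    = refl

  count-touches : ∀ i → count (touches? i) ≤ 6
  count-touches i = ≤-trans (count-∈ₗ (endpoints (F i))) (endpoints-≤ (shape i) (hs i))
    where
    endpoints-≤ : ∀ s {L : List (Edge n)} → HasShape s L → length (endpoints L) ≤ 6
    endpoints-≤ matching2 (_ , _ , _ , _ , _ , _ , _ , _ , _ , _ , refl) = s≤s (s≤s (s≤s (s≤s z≤n)))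
    endpoints-≤ triangle  (_ , _ , _ , _ , _ , refl) = ≤-refl
    endpoints-≤ single    (_ , _ , _ , refl) = s≤s (s≤s z≤n)

  count-touches-single : ∀ i → ¬ IsMT i → count (touches? i) ≤ 2
  count-touches-single i ¬mt = ≤-trans (count-∈ₗ (endpoints (F i))) (endpoints-≤ (shape i) (hs i) ¬mt)
    where
    endpoints-≤ : ∀ s {L : List (Edge n)} → HasShape s L → inMT s ≢ 1 → length (endpoints L) ≤ 2
    endpoints-≤ matching2 _ ¬mt = ⊥-elim (¬mt refl)
    endpoints-≤ triangle  _ ¬mt = ⊥-elim (¬mt refl)
    endpoints-≤ single    (_ , _ , _ , refl) _ = ≤-refl

  Clash : Fin n → Fin n → Set
  Clash x y = ∃[ i ] (IsMT i × Touches i x × Touches i y)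

  clash? : ∀ x y → Dec (Clash x y)
  clash? x y = any? (λ i → isMT? i ×-dec touches? i x ×-dec touches? i y)

  clash-sym : ∀ {x y} → Clash x y → Clash y x
  clash-sym (i , mt , tx , ty) = i , mt , ty , tx

  mtDegree : Fin n → ℕ
  mtDegree v = count (λ i → isMT? i ×-dec touches? i v)

  ∑-mtDegree : sum mtDegree ≤ 6 * n
  ∑-mtDegree = begin
    sum mtDegree                                              ≡⟨ ∑-comm (λ v i → 𝟙 (isMT? i ×-dec touches? i v)) ⟩
    sum (λ i → count (λ v → isMT? i ×-dec touches? i v))      ≤⟨ ∑-mono-≤ per-class ⟩
    sum {n} (λ _ → 6)                                         ≡⟨ trans (∑-const n 6) (*-comm n 6) ⟩
    6 * n                                                     ∎
    where
    open ≤-Reasoning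
    per-class : ∀ i → count (λ v → isMT? i ×-dec touches? i v) ≤ 6
    per-class i = ≤-trans (count-mono (λ v → isMT? i ×-dec touches? i v) (touches? i) (λ _ → proj₂)) (count-touches i)

  count-clash : ∀ d → count (λ x → clash? x d) ≤ 6 * mtDegree d
  count-clash d = count-cover (λ x → clash? x d) (λ i → isMT? i ×-dec touches? i d) (λ x i → touches? i x) 6
    (λ { x (i , mt , tx , td) → i , (mt , td) , tx })
    (λ i _ → count-touches i)

  SingleTouched : Fin n → Set
  SingleTouched v = ∃[ i ] (¬ IsMT i × Touches i v)

  singleTouched? : ∀ v → Dec (SingleTouched v)
  singleTouched? v = any? (λ i → ¬? (isMT? i) ×-dec touches? i v)

  count-singleTouched : count singleTouched? ≤ 2 * count (¬? ∘ isMT?)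
  count-singleTouched = count-cover singleTouched? (¬? ∘ isMT?) (λ v i → touches? i v) 2
    (λ _ touched → touched) count-touches-single

  Survives : Subset n → Set
  Survives H = ∀ i → ∃[ e ] (e ∈ₗ F i × proj₁ e ∈ H × proj₂ e ∈ H)

  survives⇒rainbow : ∀ {H} → Survives H → ∃[ R ] (RainbowIn F H R × length R ≡ n)
  survives⇒rainbow survives = R , (tabulate⁺ (proj₂ ∘ survives) , unique) , length-tabulate pick
    where
    pick : Fin n → Fin n × Edge n
    pick i = i , proj₁ (survives i)
    R : List (Fin n × Edge n)
    R = tabulate pick
    unique : Unique (map proj₁ R)
    unique = subst Unique (sym (map-tabulate pick proj₁)) (allFin⁺ n)

  ∈-endpoints : ∀ {L : List (Edge n)} {u v} → (u , v) ∈ₗ L → u ∈ₗ endpoints L × v ∈ₗ endpoints L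
  ∈-endpoints (here refl) = here refl , there (here refl)
  ∈-endpoints {_ ∷ _} (there uv∈L) = Product.map (there ∘ there) (there ∘ there) (∈-endpoints uv∈L)

  module _ {D : Subset n} (unsingle : ∀ {v} → v ∈ D → ¬ SingleTouched v)
           (free : ∀ {x y} → x ∈ D → y ∈ D → x ≢ y → ¬ Clash x y) where

    Avoided : Fin n → Set
    Avoided i = ∃[ e ] (e ∈ₗ F i × proj₁ e ∉ D × proj₂ e ∉ D)

    at-most-one : ∀ {i x y} → IsMT i → Touches i x → Touches i y → x ∈ D → x ≢ y → y ∉ D
    at-most-one {i} mt tx ty x∈D x≢y y∈D = free x∈D y∈D x≢y (i , mt , tx , ty)

    single-avoided : ∀ {i a b} → ¬ IsMT i → (a , b) ∈ₗ F i → Avoided i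
    single-avoided {i} ¬mt ab = _ , ab , untouched (proj₁ (∈-endpoints ab)) , untouched (proj₂ (∈-endpoints ab))
      where
      untouched : ∀ {v} → Touches i v → v ∉ D
      untouched tv v∈D = unsingle v∈D (i , ¬mt , tv)

    matching-avoided : ∀ {i a b c d} → IsMT i → (a , b) ∈ₗ F i → (c , d) ∈ₗ F i →
      a ≢ c → a ≢ d → b ≢ c → b ≢ d → Avoided i
    matching-avoided {a = a} {b} mt ab cd a≢c a≢d b≢c b≢d with a ∈? D | b ∈? D
    ... | yes a∈D | _ = _ , cd ,
      at-most-one mt (proj₁ (∈-endpoints ab)) (proj₁ (∈-endpoints cd)) a∈D a≢c ,
      at-most-one mt (proj₁ (∈-endpoints ab)) (proj₂ (∈-endpoints cd)) a∈D a≢d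
    ... | no _ | yes b∈D = _ , cd ,
      at-most-one mt (proj₂ (∈-endpoints ab)) (proj₁ (∈-endpoints cd)) b∈D b≢c ,
      at-most-one mt (proj₂ (∈-endpoints ab)) (proj₂ (∈-endpoints cd)) b∈D b≢d
    ... | no a∉D | no b∉D = _ , ab , a∉D , b∉D

    triangle-avoided : ∀ {i a b c} → IsMT i → (a , b) ∈ₗ F i → (b , c) ∈ₗ F i → (a , c) ∈ₗ F i →
      a ≢ b → a ≢ c → b ≢ c → Avoided i
    triangle-avoided {a = a} {b} mt ab bc ac a≢b a≢c b≢c with a ∈? D | b ∈? D
    ... | yes a∈D | _ = _ , bc ,
      at-most-one mt (proj₁ (∈-endpoints ab)) (proj₂ (∈-endpoints ab)) a∈D a≢b ,
      at-most-one mt (proj₁ (∈-endpoints ab)) (proj₂ (∈-endpoints ac)) a∈D a≢c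
    ... | no a∉D | yes b∈D = _ , ac , a∉D ,
      at-most-one mt (proj₁ (∈-endpoints bc)) (proj₂ (∈-endpoints bc)) b∈D b≢c
    ... | no a∉D | no b∉D = _ , ab , a∉D , b∉D

    avoided : ∀ i → Avoided i
    avoided i = by-shape (shape i) refl (hs i)
      where
      edge : ∀ {L e} → F i ≡ L → e ∈ₗ L → e ∈ₗ F i
      edge Fi≡L = subst (_ ∈ₗ_) (sym Fi≡L)
      by-shape : ∀ s → shape i ≡ s → HasShape s (F i) → Avoided i
      by-shape single eq (_ , _ , _ , Fi≡) =
        single-avoided (λ mt → 0≢1+n (trans (sym (cong inMT eq)) mt)) (edge Fi≡ (here refl))
      by-shape matching2 eq (_ , _ , _ , _ , _ , _ , a≢c , a≢d , b≢c , b≢d , Fi≡) =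
        matching-avoided (cong inMT eq) (edge Fi≡ (here refl)) (edge Fi≡ (there (here refl))) a≢c a≢d b≢c b≢d
      by-shape triangle eq (_ , _ , _ , a<b , b<c , Fi≡) =
        triangle-avoided (cong inMT eq) (edge Fi≡ (here refl)) (edge Fi≡ (there (here refl)))
          (edge Fi≡ (there (there (here refl)))) (<⇒≢ a<b) (<⇒≢ (<-trans a<b b<c)) (<⇒≢ b<c)

    complement-survives : Survives (∁ D)
    complement-survives i with avoided i
    ... | e , e∈Fi , u∉D , v∉D = e , e∈Fi , x∉p⇒x∈∁p u∉D , x∉p⇒x∈∁p v∉D

  module Threshold (T : ℕ) where

    Good : Fin n → Set
    Good v = ¬ SingleTouched v × ¬ T ≤ mtDegree v

    good? : ∀ v → Dec (Good v)
    good? v = ¬? (singleTouched? v) ×-dec ¬? (T ≤? mtDegree v)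

    open MaximalIndependentSet good? clash? clash-sym

    count-neighbourhood : ∀ d → Good d → count (λ x → x ≟ d ⊎-dec clash? x d) ≤ 6 * T
    count-neighbourhood d (_ , light) = begin
      count (λ x → x ≟ d ⊎-dec clash? x d)    ≤⟨ count-⊎ (_≟ d) (λ x → clash? x d) ⟩
      count (_≟ d) + count (λ x → clash? x d) ≤⟨ +-mono-≤ (≤-reflexive (count-≡ d)) (count-clash d) ⟩
      1 + 6 * mtDegree d                          ≤⟨ +-monoˡ-≤ (6 * mtDegree d) (s≤s (z≤n {5})) ⟩
      6 + 6 * mtDegree d                          ≡⟨ *-suc 6 (mtDegree d) ⟨
      6 * suc (mtDegree d)                        ≤⟨ *-monoʳ-≤ 6 (≰⇒> light) ⟩
      6 * T                                   ∎
      where open ≤-Reasoning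

    count-partition : n ≤ count good? + (count singleTouched? + count (λ v → T ≤? mtDegree v))
    count-partition = begin
      n                  ≡⟨ count-total every-vertex classify ⟨
      count every-vertex ≤⟨ count-⊎ good? (λ v → singleTouched? v ⊎-dec T ≤? mtDegree v) ⟩
      count good? + count (λ v → singleTouched? v ⊎-dec T ≤? mtDegree v)
                         ≤⟨ +-monoʳ-≤ (count good?) (count-⊎ singleTouched? (λ v → T ≤? mtDegree v)) ⟩
      count good? + (count singleTouched? + count (λ v → T ≤? mtDegree v)) ∎
      where
      open ≤-Reasoning
      every-vertex : Decidable (λ v → Good v ⊎ (SingleTouched v ⊎ T ≤ mtDegree v))
      every-vertex v = good? v ⊎-dec (singleTouched? v ⊎-dec T ≤? mtDegree v)
      classify : ∀ v → Good v ⊎ (SingleTouched v ⊎ T ≤ mtDegree v)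
      classify v with singleTouched? v | T ≤? mtDegree v
      ... | yes s | _     = inj₂ (inj₁ s)
      ... | no _  | yes h = inj₂ (inj₂ h)
      ... | no ¬s | no ¬h = inj₁ (¬s , ¬h)

    count-heavy : T * count (λ v → T ≤? mtDegree v) ≤ 6 * n
    count-heavy = ≤-trans (markov T mtDegree) ∑-mtDegree

    good-dominated : ∃[ D ] (Independent D × count good? ≤ 6 * T * ∣ D ∣)
    good-dominated with maximal-independent
    ... | D , ind , dominated = D , ind ,
      subst (count good? ≤_) (cong (6 * T *_) (sym (∣p∣≡count D)))
        (count-cover good? (_∈? D) (λ x d → x ≟ d ⊎-dec clash? x d) (6 * T) (λ _ → dominated)
          (λ d d∈D → count-neighbourhood d (Independent.⊆P ind d∈D)))

  large-removable : ∀ {p Q} → suc Q ≤ 2 * p → p * n ≤ Q * countMT shape →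
    ∃[ D ] (n ≤ 144 * Q * Q * ∣ D ∣ × Survives (∁ D))
  large-removable {p} {Q} Q<2p dense with Threshold.good-dominated (12 * Q)
  ... | D , ind , good≤ = D , size , complement-survives (proj₁ ∘ ⊆P) free
    where
    open Threshold (12 * Q)
    open MaximalIndependentSet.Independent ind
    size : n ≤ 144 * Q * Q * ∣ D ∣
    size = begin
      n                                      ≤⟨ good-fraction {p} Q<2p dense classes partition count-heavy ⟩
      2 * Q * count good?                    ≤⟨ *-monoʳ-≤ (2 * Q) good≤ ⟩
      2 * Q * (6 * (12 * Q) * ∣ D ∣)          ≡⟨ rearrange Q ∣ D ∣ ⟩
      144 * Q * Q * ∣ D ∣                     ∎
      where
      open ≤-Reasoning
      classes : count (¬? ∘ isMT?) + countMT shape ≡ n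
      classes = trans (cong (count (¬? ∘ isMT?) +_) (sym count-isMT)) (count-¬ isMT?)
      partition : n ≤ count good? + (2 * count (¬? ∘ isMT?) + count (λ v → 12 * Q ≤? mtDegree v))
      partition = ≤-trans count-partition (+-monoʳ-≤ (count good?) (+-monoˡ-≤ _ count-singleTouched))
      rearrange : ∀ Q d → 2 * Q * (6 * (12 * Q) * d) ≡ 144 * Q * Q * d
      rearrange = solve-∀

open import Data.Nat using (ℕ; _≤_)
open import Data.Fin using (Fin)
open import Data.Fin.Subset using (Subset; ∣_∣)
open import Data.Product using (_×_; Σ; ∃-syntax)
open import Data.List using (List; length)
open import Data.Rational using (ℚ; ½; 0ℚ; _<_; _*_; _+_) renaming (_≤_ to _≤ℚ_)

import Data.Nat as ℕ
import Data.Nat.Properties as ℕ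
open import Data.Fin.Subset using (∁)
open import Data.Integer using (+_; -[1+_])
open import Data.Product using (_,_)
open import Data.Rational using (mkℚ; *<*; _/_)
open import Data.Rational.Properties using (*-identityˡ; ≤-reflexive)
open import Relation.Binary.PropositionalEquality using (_≡_; cong; cong₂; trans; sym)

open Arithmetic using (complement-bound)
open RationalBounds

theorem3p2 : (α : ℚ) → ½ < α →
    ∃[ β ] ∃[ γ ] (0ℚ < β × 0ℚ < γ × ∃[ N₀ ] (∀ (n : ℕ) → N₀ ≤ n →
      (F : Fin n → List (Edge n)) (shape : Fin n → Shape) →
      (∀ i → HasShape (shape i) (F i)) →
      PairwiseDisjoint F →
      α * ℕ→ℚ n ≤ℚ ℕ→ℚ (countMT shape) →
      ∃[ H ] (ℕ→ℚ ∣ H ∣ ≤ℚ β * ℕ→ℚ n ×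
        ∃[ R ] (RainbowIn F H R × (β + γ) * ℕ→ℚ n ≤ℚ ℕ→ℚ (length R)))))
theorem3p2 (mkℚ -[1+ _ ] _ _) (*<* ())
theorem3p2 (mkℚ (+ p) q _) ½<α = β , γ , 0<frac K (ℕ.suc K) , 0<frac 0 (ℕ.suc K) , 0 ,
  λ n _ F shape hs _ dense →
    let open ColourClasses F shape hs
        (D , n≤KD , survives) = large-removable {p} (½<⇒ ½<α) (frac*ℕ→ℚ≤ℕ→ℚ n (countMT shape) dense)
        (R , rainbow , |R|≡n) = survives⇒rainbow survives
    in ∁ D , ℕ→ℚ≤frac*ℕ→ℚ ∣ ∁ D ∣ (ℕ.suc K) (ℕ.suc K) n (complement-bound (ℕ.suc K) D (loosen n≤KD)) ,
       R , rainbow , full-size |R|≡n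
  where
  K : ℕ
  K = 144 ℕ.* ℕ.suc q ℕ.* ℕ.suc q
  β γ : ℚ
  β = + ℕ.suc K / ℕ.suc (ℕ.suc K)
  γ = + 1 / ℕ.suc (ℕ.suc K)
  loosen : ∀ {n d} → n ≤ K ℕ.* d → n ≤ ℕ.suc (ℕ.suc K) ℕ.* d
  loosen {d = d} n≤Kd = ℕ.≤-trans n≤Kd (ℕ.*-monoˡ-≤ d (ℕ.m≤n+m K 2))
  full-size : ∀ {m n} → m ≡ n → (β + γ) * ℕ→ℚ n ≤ℚ ℕ→ℚ m
  full-size m≡n = ≤-reflexive (trans (cong₂ _*_ (frac+frac≡1 (ℕ.suc K)) (cong ℕ→ℚ (sym m≡n))) (*-identityˡ _))
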